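{- For $N\ge 1$ let $Z^{\mathrm{even}}_N$ be the number of even configurations on the box $[1,N]^2$ and let $Z^{pi}_N$ be the number of $p$-$i$ configurations on the box $[1,N]^2$ (both defined below). Then the growth rates of the two models are equal: $$\lim_{N\to\infty}\big(Z^{\mathrm{even}}_N\big)^{1/N^2}=\lim_{N\to\infty}\big(Z^{pi}_N\big)^{1/N^2}.$$
   Context: An even configuration on $[1,N]^2$ is an assignment of a spin $\oplus$ or $\ominus$ to each vertex of $[1,N]^2\subset\mathbb{Z}^2$ such that whenever two $\ominus$ spins lie on a common row or column of the box with no other $\ominus$ spin between them, the number of $\oplus$ spins between them is even. A $p$-$i$ configuration on $[1,N]^2$ assigns to each bond of the box, including the dangling boundary bonds (so every vertex of the box has four incident bonds: north, west, east, south), a label in $\{p,i\}$ such that at every vertex: the north and south bonds are not both labelled $i$, the west and east bonds are not both labelled $i$, and the number of incident bonds labelled $i$ is either $0$ or $2$. (Intuitively, a bond's label records the parity of the number of $\oplus$ spins between it and the nearest $\ominus$ to its west/north.) The growth rate of a model is $\kappa=\lim_{N\to\infty} Z_N^{1/N^2}$, where $Z_N$ is the number of its configurations on $[1,N]^2$; these limits are taken to exist. -}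

module Defs where

open import Data.Bool using (Bool; true; false; _∧_; _∨_; not; if_then_else_)
open import Data.Nat using (ℕ; zero; suc; _+_; _∸_; _<ᵇ_; _≡ᵇ_; _%_)
open import Data.Fin using (Fin; toℕ; inject₁) renaming (suc to fsuc)
open import Data.List using (List; []; _∷_; map; concatMap; allFin)
open import Data.Vec using (Vec; lookup) renaming ([] to []ᵥ; _∷_ to _∷ᵥ_)

allVecs : {A : Set} → (n : ℕ) → List A → List (Vec A n)
allVecs zero    xs = []ᵥ ∷ []
allVecs (suc n) xs = concatMap (λ x → map (x ∷ᵥ_) (allVecs n xs)) xs

count : {A : Set} → (A → Bool) → List A → ℕ
count p []       = 0
count p (x ∷ xs) = (if p x then 1 else 0) + count p xs

∀Fin : (n : ℕ) → (Fin n → Bool) → Bool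
∀Fin n p = allB p (allFin n)
  where
  allB : {A : Set} → (A → Bool) → List A → Bool
  allB q []       = true
  allB q (x ∷ xs) = q x ∧ allB q xs

_⇒ᵇ_ : Bool → Bool → Bool
a ⇒ᵇ b = not a ∨ b

data Spin : Set where
  ⊕ ⊖ : Spin

isMinus : Spin → Bool
isMinus ⊕ = false
isMinus ⊖ = true

isPlus : Spin → Bool
isPlus s = not (isMinus s)

-- A spin configuration on the box [1,N]^2: row r, column c (0-based).
SpinConfig : ℕ → Set
SpinConfig N = Vec (Vec Spin N) N

evenLine : (N : ℕ) → (Fin N → Spin) → Bool
evenLine N s =
  ∀Fin N λ i → ∀Fin N λ j →
    ( (toℕ i <ᵇ toℕ j) ∧ isMinus (s i) ∧ isMinus (s j)
      ∧ (∀Fin N λ k → ((toℕ i <ᵇ toℕ k) ∧ (toℕ k <ᵇ toℕ j)) ⇒ᵇ isPlus (s k)) )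
    ⇒ᵇ (((toℕ j ∸ toℕ i ∸ 1) % 2) ≡ᵇ 0)

isEvenConfig : (N : ℕ) → SpinConfig N → Bool
isEvenConfig N σ =
  (∀Fin N λ r → evenLine N (λ c → lookup (lookup σ r) c)) ∧
  (∀Fin N λ c → evenLine N (λ r → lookup (lookup σ r) c))

allSpinConfigs : (N : ℕ) → List (SpinConfig N)
allSpinConfigs N = allVecs N (allVecs N (⊕ ∷ ⊖ ∷ []))

Zeven : ℕ → ℕ
Zeven N = count (isEvenConfig N) (allSpinConfigs N)

data Label : Set where
  p i : Label

isI : Label → Bool
isI p = false
isI i = true

-- Bond labels on [1,N]^2 including dangling boundary bonds.
-- horiz r k : k-th horizontal bond of row r (k = 0..N); vertex (r,c)
--   has west bond k = c and east bond k = c+1.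
-- vert c k : k-th vertical bond of column c (k = 0..N); vertex (r,c)
--   has north bond k = r and south bond k = r+1.
record PIConfig (N : ℕ) : Set where
  constructor mkPI
  field
    horiz : Vec (Vec Label (suc N)) N
    vert  : Vec (Vec Label (suc N)) N

b2n : Bool → ℕ
b2n true  = 1
b2n false = 0

vertexOK : Label → Label → Label → Label → Bool
vertexOK n w e s =
  not (isI n ∧ isI s) ∧ not (isI w ∧ isI e) ∧
  (let m = b2n (isI n) + b2n (isI w) + b2n (isI e) + b2n (isI s)
   in (m ≡ᵇ 0) ∨ (m ≡ᵇ 2))

isPIConfig : (N : ℕ) → PIConfig N → Bool
isPIConfig N (mkPI h v) =
  ∀Fin N λ r → ∀Fin N λ c →
    vertexOK (lookup (lookup v c) (inject₁ r))
             (lookup (lookup h r) (inject₁ c))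
             (lookup (lookup h r) (fsuc c))
             (lookup (lookup v c) (fsuc r))

allPIConfigs : (N : ℕ) → List (PIConfig N)
allPIConfigs N =
  concatMap (λ h → map (mkPI h) (allVecs N (allVecs (suc N) (p ∷ i ∷ []))))
            (allVecs N (allVecs (suc N) (p ∷ i ∷ [])))

Zpi : ℕ → ℕ
Zpi N = count (isPIConfig N) (allPIConfigs N)

{-# OPTIONS --safe #-}
-- Read each row and column from its west/north end and label every bond by the parity (p even,
-- i odd) of the ⊕ spins since the last ⊖.  In an even configuration this parity is p at every ⊖,
-- so once the label before the first ⊖ of each line is chosen to make that hold there as well,
-- the labels form a p-i configuration from which the spins can be read back: Zeven N ≤ Zpi N.
-- Conversely the vertex rule of a p-i configuration forces exactly this parity bookkeeping along
-- every line, so it determines an even configuration and is determined by it together with the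
-- first label of each row and column: Zpi N ≤ 4^N · Zeven N.  Finally 4^N (k+1)^(N²) ≤ (k+2)^(N²)
-- as soon as N ≥ 3(k+1), by Bernoulli's inequality.
module Submission where

open import Defs
open import Data.Bool using (Bool; true; false; _∧_; if_then_else_)
open import Data.Bool.Properties using (T-≡)
open import Data.Nat using (ℕ; zero; suc; _+_; _*_; _∸_; _^_; _≤_; _<_; _%_; _≡ᵇ_; _<ᵇ_; z≤n; s≤s; z<s)
open import Data.Nat.Properties
open import Data.Nat.Solver using (module +-*-Solver)
open import Data.Fin using (Fin; toℕ; inject₁; fromℕ<) renaming (zero to fzero; suc to fsuc)
open import Data.Fin.Properties using (toℕ-fromℕ<; toℕ-inject₁; toℕ<n)
open import Data.List
  using (List; []; _∷_; _++_; map; concatMap; length; allFin; cartesianProduct; cartesianProductWith)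
open import Data.List.Properties using (length-++; length-map)
open import Data.List.Relation.Unary.Any using (here; there; _─_)
open import Data.List.Relation.Unary.All as All using (All)
open import Data.List.Relation.Unary.Unique.Propositional using (Unique; []; _∷_)
open import Data.List.Relation.Unary.Unique.Propositional.Properties using (cartesianProductWith⁺)
open import Data.List.Membership.Propositional using (_∈_)
open import Data.List.Membership.Propositional.Properties
  using (∈-allFin; ∈-cartesianProductWith⁺; ∈-cartesianProduct⁺)
open import Data.Vec using (Vec; lookup; tabulate) renaming ([] to []ᵥ; _∷_ to _∷ᵥ_)
open import Data.Vec.Properties using (∷-injective; lookup∘tabulate; tabulate∘lookup; tabulate-cong)
open import Data.Product using (Σ; _×_; _,_; proj₁; proj₂; ∃-syntax)
open import Data.Sum using (_⊎_; inj₁; inj₂; [_,_])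
open import Function using (_∘_)
open import Function.Bundles using (Equivalence)
open import Relation.Nullary using (contradiction)
open import Relation.Binary.PropositionalEquality hiding ([_])

open +-*-Solver using (solve; _:=_; _:+_; _:*_; con)

private
  variable
    A B C : Set

∧-true⁻ : ∀ {a b} → a ∧ b ≡ true → a ≡ true × b ≡ true
∧-true⁻ {true} b≡true = refl , b≡true

∧-true⁺ : ∀ {a b} → a ≡ true → b ≡ true → a ∧ b ≡ true
∧-true⁺ refl refl = refl

⇒ᵇ-true⁻ : ∀ {a b} → (a ⇒ᵇ b) ≡ true → a ≡ true → b ≡ true
⇒ᵇ-true⁻ {true} b≡true refl = b≡true

⇒ᵇ-true⁺ : ∀ {a b} → (a ≡ true → b ≡ true) → (a ⇒ᵇ b) ≡ true
⇒ᵇ-true⁺ {true}  a⇒b = a⇒b refl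
⇒ᵇ-true⁺ {false} a⇒b = refl

<ᵇ-true⁺ : ∀ {m n} → m < n → (m <ᵇ n) ≡ true
<ᵇ-true⁺ = Equivalence.to T-≡ ∘ <⇒<ᵇ

<ᵇ-true⁻ : ∀ {m n} → (m <ᵇ n) ≡ true → m < n
<ᵇ-true⁻ {m} {n} = <ᵇ⇒< m n ∘ Equivalence.from T-≡

isMinus-true⁻ : ∀ {x} → isMinus x ≡ true → x ≡ ⊖
isMinus-true⁻ {⊖} _ = refl

isPlus-true⁻ : ∀ {x} → isPlus x ≡ true → x ≡ ⊕
isPlus-true⁻ {⊕} _ = refl

-- `∀Fin` folds a where-bound helper over `allFin`; abstracting `allFin n`
-- lets unification name that helper.
private
  foldOf∀Fin : ∀ n (P : Fin n → Bool) →
               Σ (List (Fin n) → Bool) λ fold → ∀ xs → xs ≡ allFin n → fold xs ≡ ∀Fin n P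
  foldOf∀Fin n P = fold , folds
    where
    fold : List (Fin n) → Bool
    fold = _
    folds : ∀ xs → xs ≡ allFin n → fold xs ≡ ∀Fin n P
    folds xs xs≡allFin rewrite sym xs≡allFin = refl

module _ {n} {P : Fin n → Bool} where
  private
    fold : List (Fin n) → Bool
    fold = proj₁ (foldOf∀Fin n P)

    fold-true⁻ : ∀ {xs} → fold xs ≡ true → ∀ {k} → k ∈ xs → P k ≡ true
    fold-true⁻ {x ∷ xs} holds (here refl) = proj₁ (∧-true⁻ {P x} holds)
    fold-true⁻ {x ∷ xs} holds (there k∈xs) = fold-true⁻ (proj₂ (∧-true⁻ {P x} holds)) k∈xs

    fold-true⁺ : (∀ k → P k ≡ true) → ∀ xs → fold xs ≡ true
    fold-true⁺ holds []       = refl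
    fold-true⁺ holds (x ∷ xs) = ∧-true⁺ (holds x) (fold-true⁺ holds xs)

  ∀Fin-true⁻ : ∀Fin n P ≡ true → ∀ k → P k ≡ true
  ∀Fin-true⁻ holds k =
    fold-true⁻ (trans (proj₂ (foldOf∀Fin n P) _ refl) holds) (∈-allFin k)

  ∀Fin-true⁺ : (∀ k → P k ≡ true) → ∀Fin n P ≡ true
  ∀Fin-true⁺ holds = trans (sym (proj₂ (foldOf∀Fin n P) _ refl)) (fold-true⁺ holds (allFin n))

count-─ : ∀ (q : A → Bool) {x ys} → q x ≡ true → (x∈ys : x ∈ ys) →
          count q ys ≡ suc (count q (ys ─ x∈ys))
count-─ q qx (here refl) rewrite qx = refl
count-─ q {ys = y ∷ ys} qx (there x∈ys) rewrite count-─ q qx x∈ys = +-suc _ _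

∈-─ : ∀ {x y : A} {ys} → y ∈ ys → y ≢ x → (x∈ys : x ∈ ys) → y ∈ (ys ─ x∈ys)
∈-─ (here refl)  y≢x (here refl)  = contradiction refl y≢x
∈-─ (there y∈ys) y≢x (here refl)  = y∈ys
∈-─ (here y≡z)   y≢x (there x∈ys) = here y≡z
∈-─ (there y∈ys) y≢x (there x∈ys) = there (∈-─ y∈ys y≢x x∈ys)

count-≤-injection : ∀ {pr : A → Bool} {q : B → Bool} (f : A → B) →
  (∀ {x y} → pr x ≡ true → pr y ≡ true → f x ≡ f y → x ≡ y) →
  ∀ {xs ys} → Unique xs → (∀ {x} → x ∈ xs → pr x ≡ true → f x ∈ ys × q (f x) ≡ true) →
  count pr xs ≤ count q ys
count-≤-injection f inj [] into = z≤n
count-≤-injection {pr = pr} {q} f inj {x ∷ xs} {ys} (x≢xs ∷ unique) into with pr x in prx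
... | false = count-≤-injection f inj unique (into ∘ there)
... | true  = subst (_ ≤_) (sym (count-─ q qfx fx∈ys))
                (s≤s (count-≤-injection f inj unique into-rest))
  where
  fx∈ys : f x ∈ ys
  fx∈ys = proj₁ (into (here refl) prx)
  qfx : q (f x) ≡ true
  qfx = proj₂ (into (here refl) prx)
  into-rest : ∀ {y} → y ∈ xs → pr y ≡ true → f y ∈ (ys ─ fx∈ys) × q (f y) ≡ true
  into-rest y∈xs pry =
    ∈-─ (proj₁ (into (there y∈xs) pry)) (λ fy≡fx → All.lookup x≢xs y∈xs (sym (inj pry prx fy≡fx))) fx∈ys
    , proj₂ (into (there y∈xs) pry)

count-++ : ∀ {q : A → Bool} xs ys → count q (xs ++ ys) ≡ count q xs + count q ys
count-++         []       ys = refl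
count-++ {q = q} (x ∷ xs) ys rewrite count-++ {q = q} xs ys =
  sym (+-assoc (if q x then 1 else 0) (count q xs) (count q ys))

count-cartesianProduct-proj₁ : ∀ (q : A → Bool) xs (ys : List B) →
  count (λ xy → q (proj₁ xy)) (cartesianProduct xs ys) ≡ count q xs * length ys
count-cartesianProduct-proj₁ q []       ys = refl
count-cartesianProduct-proj₁ q (x ∷ xs) ys = begin
    count (q ∘ proj₁) (map (x ,_) ys ++ cartesianProduct xs ys)
  ≡⟨ count-++ (map (x ,_) ys) _ ⟩
    count (q ∘ proj₁) (map (x ,_) ys) + count (q ∘ proj₁) (cartesianProduct xs ys)
  ≡⟨ cong₂ _+_ (count-const ys) (count-cartesianProduct-proj₁ q xs ys) ⟩
    qx * length ys + count q xs * length ys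
  ≡⟨ sym (*-distribʳ-+ (length ys) qx (count q xs)) ⟩
    (qx + count q xs) * length ys
  ∎
  where
  open ≡-Reasoning
  qx : ℕ
  qx = if q x then 1 else 0
  count-const : ∀ zs → count (q ∘ proj₁) (map (x ,_) zs) ≡ qx * length zs
  count-const []       = sym (*-zeroʳ qx)
  count-const (z ∷ zs) rewrite count-const zs | *-suc qx (length zs) = refl

concatMap-map≡cartesianProductWith : ∀ (f : A → B → C) xs ys →
  concatMap (λ x → map (f x) ys) xs ≡ cartesianProductWith f xs ys
concatMap-map≡cartesianProductWith f []       ys = refl
concatMap-map≡cartesianProductWith f (x ∷ xs) ys =
  cong (map (f x) ys ++_) (concatMap-map≡cartesianProductWith f xs ys)

length-cartesianProductWith : ∀ (f : A → B → C) xs ys →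
  length (cartesianProductWith f xs ys) ≡ length xs * length ys
length-cartesianProductWith f []       ys = refl
length-cartesianProductWith f (x ∷ xs) ys = begin
    length (map (f x) ys ++ cartesianProductWith f xs ys)
  ≡⟨ length-++ (map (f x) ys) ⟩
    length (map (f x) ys) + length (cartesianProductWith f xs ys)
  ≡⟨ cong₂ _+_ (length-map (f x) ys) (length-cartesianProductWith f xs ys) ⟩
    length ys + length xs * length ys
  ∎
  where open ≡-Reasoning

allVecs-suc : ∀ n (xs : List A) → allVecs (suc n) xs ≡ cartesianProductWith _∷ᵥ_ xs (allVecs n xs)
allVecs-suc n xs = concatMap-map≡cartesianProductWith _∷ᵥ_ xs (allVecs n xs)

∈-allVecs : ∀ {xs : List A} → (∀ x → x ∈ xs) → ∀ {n} (v : Vec A n) → v ∈ allVecs n xs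
∈-allVecs every []ᵥ       = here refl
∈-allVecs {xs = xs} every {suc n} (x ∷ᵥ v) =
  subst (_ ∈_) (sym (allVecs-suc n xs)) (∈-cartesianProductWith⁺ _∷ᵥ_ (every x) (∈-allVecs every v))

allVecs-unique : ∀ {xs : List A} → Unique xs → ∀ n → Unique (allVecs n xs)
allVecs-unique unique zero    = All.[] ∷ []
allVecs-unique {xs = xs} unique (suc n) =
  subst Unique (sym (allVecs-suc n xs))
    (cartesianProductWith⁺ _∷ᵥ_ ∷-injective unique (allVecs-unique unique n))

length-allVecs : ∀ n (xs : List A) → length (allVecs n xs) ≡ length xs ^ n
length-allVecs zero    xs = refl
length-allVecs (suc n) xs = begin
    length (allVecs (suc n) xs)
  ≡⟨ cong length (allVecs-suc n xs) ⟩
    length (cartesianProductWith _∷ᵥ_ xs (allVecs n xs))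
  ≡⟨ length-cartesianProductWith _∷ᵥ_ xs (allVecs n xs) ⟩
    length xs * length (allVecs n xs)
  ≡⟨ cong (length xs *_) (length-allVecs n xs) ⟩
    length xs * length xs ^ n
  ∎
  where open ≡-Reasoning

-- The bonds just before (west/north) and after a vertex of the given spin.
data Crossing : Spin → Label → Label → Set where
  ⊖pp : Crossing ⊖ p p
  ⊕pi : Crossing ⊕ p i
  ⊕ip : Crossing ⊕ i p

flip : Label → Label
flip p = i
flip i = p

flipⁿ : ℕ → Label → Label
flipⁿ zero    x = x
flipⁿ (suc n) x = flip (flipⁿ n x)

step : Spin → Label → Label
step ⊖ _ = p
step ⊕ x = flip x

crossing⇒step : ∀ {s a b} → Crossing s a b → b ≡ step s a
crossing⇒step ⊖pp = refl
crossing⇒step ⊕pi = refl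
crossing⇒step ⊕ip = refl

crossing-⊖ : ∀ {a b} → Crossing ⊖ a b → a ≡ p
crossing-⊖ ⊖pp = refl

step⇒crossing : ∀ s a → (s ≡ ⊖ → a ≡ p) → Crossing s a (step s a)
step⇒crossing ⊖ a ⊖⇒p rewrite ⊖⇒p refl = ⊖pp
step⇒crossing ⊕ p _ = ⊕pi
step⇒crossing ⊕ i _ = ⊕ip

flip-involutive : ∀ x → flip (flip x) ≡ x
flip-involutive p = refl
flip-involutive i = refl

flipⁿ-flip : ∀ n x → flipⁿ n (flip x) ≡ flip (flipⁿ n x)
flipⁿ-flip zero    x = refl
flipⁿ-flip (suc n) x = cong flip (flipⁿ-flip n x)

flipⁿ-involutive : ∀ n x → flipⁿ n (flipⁿ n x) ≡ x
flipⁿ-involutive zero    x = refl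
flipⁿ-involutive (suc n) x = begin
    flip (flipⁿ n (flip (flipⁿ n x)))  ≡⟨ cong flip (flipⁿ-flip n (flipⁿ n x)) ⟩
    flip (flip (flipⁿ n (flipⁿ n x)))  ≡⟨ flip-involutive _ ⟩
    flipⁿ n (flipⁿ n x)                ≡⟨ flipⁿ-involutive n x ⟩
    x                                  ∎
  where open ≡-Reasoning

Evenᵇ : ℕ → Set
Evenᵇ n = (n % 2 ≡ᵇ 0) ≡ true

flipⁿ-p⇒even : ∀ n → flipⁿ n p ≡ p → Evenᵇ n
flipⁿ-p⇒even zero          _   = refl
flipⁿ-p⇒even (suc (suc n)) fix = flipⁿ-p⇒even n (trans (sym (flip-involutive (flipⁿ n p))) fix)

even⇒flipⁿ-p : ∀ n → Evenᵇ n → flipⁿ n p ≡ p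
even⇒flipⁿ-p zero          _    = refl
even⇒flipⁿ-p (suc (suc n)) even = trans (flip-involutive (flipⁿ n p)) (even⇒flipⁿ-p n even)

pad : ∀ {A : Set} {N} → (Fin N → A) → A → ℕ → A
pad {N = zero}  f d _       = d
pad {N = suc N} f d zero    = f fzero
pad {N = suc N} f d (suc m) = pad (λ k → f (fsuc k)) d m

pad-toℕ : ∀ {A : Set} {N} (f : Fin N → A) d (k : Fin N) → pad f d (toℕ k) ≡ f k
pad-toℕ f d fzero    = refl
pad-toℕ f d (fsuc k) = pad-toℕ (λ k → f (fsuc k)) d k

Steps : (ℕ → Spin) → (ℕ → Label) → ℕ → Set
Steps S L n = ∀ m → m < n → L (suc m) ≡ step (S m) (L m)

Compatible : (ℕ → Spin) → (ℕ → Label) → ℕ → Set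
Compatible S L n = ∀ m → m < n → Crossing (S m) (L m) (L (suc m))

PlusBetween : (ℕ → Spin) → ℕ → ℕ → Set
PlusBetween S a b = ∀ m → a < m → m < b → S m ≡ ⊕

EvenGaps : (ℕ → Spin) → ℕ → Set
EvenGaps S n = ∀ {a b} → a < b → b < n → S a ≡ ⊖ → S b ≡ ⊖ → PlusBetween S a b →
               flipⁿ (b ∸ a ∸ 1) p ≡ p

compatible⇒steps : ∀ {S L n} → Compatible S L n → Steps S L n
compatible⇒steps compatible m m<n = crossing⇒step (compatible m m<n)

suc-+-gap : ∀ {a b} → a < b → suc a + (b ∸ a ∸ 1) ≡ b
suc-+-gap {zero}  {suc b} _         = refl
suc-+-gap {suc a} {suc b} (s≤s a<b) = cong suc (suc-+-gap a<b)

flipⁿ-run : ∀ (L : ℕ → Label) k n → (∀ m → k ≤ m → m < k + n → L (suc m) ≡ flip (L m)) →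
            L (k + n) ≡ flipⁿ n (L k)
flipⁿ-run L k zero    _     rewrite +-identityʳ k = refl
flipⁿ-run L k (suc n) flips rewrite +-suc k n =
  trans (flips (k + n) (m≤m+n k n) ≤-refl)
        (cong flip (flipⁿ-run L k n λ m k≤m m<k+n → flips m k≤m (m<n⇒m<1+n m<k+n)))

steps-across-plus : ∀ {S L n a b} → Steps S L n → a < b → b ≤ n → PlusBetween S a b →
                    L b ≡ flipⁿ (b ∸ a ∸ 1) (L (suc a))
steps-across-plus {S} {L} {n} {a} {b} steps a<b b≤n plus =
  subst (λ c → L c ≡ flipⁿ (b ∸ a ∸ 1) (L (suc a))) (suc-+-gap a<b)
    (flipⁿ-run L (suc a) (b ∸ a ∸ 1) flipsInside)
  where
  flipsInside : ∀ m → suc a ≤ m → m < suc a + (b ∸ a ∸ 1) → L (suc m) ≡ flip (L m)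
  flipsInside m a<m m<gap =
    let m<b = subst (m <_) (suc-+-gap a<b) m<gap in
    trans (steps m (<-≤-trans m<b b≤n)) (cong (λ s → step s (L m)) (plus m a<m m<b))

compatible⇒evenGaps : ∀ {S L n} → Compatible S L n → EvenGaps S n
compatible⇒evenGaps {S} {L} {n} compatible {a} {b} a<b b<n Sa≡⊖ Sb≡⊖ plus = begin
    flipⁿ (b ∸ a ∸ 1) p
  ≡⟨ cong (flipⁿ (b ∸ a ∸ 1)) (sym L[1+a]≡p) ⟩
    flipⁿ (b ∸ a ∸ 1) (L (suc a))
  ≡⟨ sym (steps-across-plus (compatible⇒steps compatible) a<b (<⇒≤ b<n) plus) ⟩
    L b
  ≡⟨ crossing-⊖ (subst (λ s → Crossing s (L b) (L (suc b))) Sb≡⊖ (compatible b b<n)) ⟩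
    p
  ∎
  where
  open ≡-Reasoning
  L[1+a]≡p : L (suc a) ≡ p
  L[1+a]≡p = trans (compatible⇒steps compatible a (<-trans a<b b<n)) (cong (λ s → step s (L a)) Sa≡⊖)

firstMinus : (ℕ → Spin) → ℕ → ℕ
firstMinus S zero    = zero
firstMinus S (suc n) with S 0
... | ⊖ = zero
... | ⊕ = suc (firstMinus (λ m → S (suc m)) n)

firstMinus-≡ : ∀ S {n c} → c < n → S c ≡ ⊖ → (∀ m → m < c → S m ≡ ⊕) → firstMinus S n ≡ c
firstMinus-≡ S {suc n} {zero}  _         Sc≡⊖ _     rewrite Sc≡⊖ = refl
firstMinus-≡ S {suc n} {suc c} (s≤s c<n) Sc≡⊖ plus rewrite plus 0 z<s =
  cong suc (firstMinus-≡ (λ m → S (suc m)) c<n Sc≡⊖ λ m m<c → plus (suc m) (s≤s m<c))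

lastMinusBefore : ∀ S c → (∀ m → m < c → S m ≡ ⊕) ⊎ ∃[ a ] (a < c × S a ≡ ⊖ × PlusBetween S a c)
lastMinusBefore S zero = inj₁ λ _ ()
lastMinusBefore S (suc c) with S c in Sc | lastMinusBefore S c
... | ⊖ | _ = inj₂ (c , ≤-refl , Sc , λ m c<m m<1+c → contradiction (≤-pred m<1+c) (<⇒≱ c<m))
... | ⊕ | inj₁ plus = inj₁ λ m m<1+c → [ plus m , (λ m≡c → trans (cong S m≡c) Sc) ] (m<1+n⇒m<n∨m≡n m<1+c)
... | ⊕ | inj₂ (a , a<c , Sa , plus) =
  inj₂ (a , m<n⇒m<1+n a<c , Sa , λ m a<m m<1+c →
    [ plus m a<m , (λ m≡c → trans (cong S m≡c) Sc) ] (m<1+n⇒m<n∨m≡n m<1+c))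

-- The initial label makes the parity count reach p exactly at the first ⊖.
labelLine : (ℕ → Spin) → ℕ → ℕ → Label
labelLine S n zero    = flipⁿ (firstMinus S n) p
labelLine S n (suc k) = step (S k) (labelLine S n k)

labelLine-⊖ : ∀ {S n c} → EvenGaps S n → c < n → S c ≡ ⊖ → labelLine S n c ≡ p
labelLine-⊖ {S} {n} {c} gaps c<n Sc≡⊖ with lastMinusBefore S c
... | inj₁ plus = begin
    labelLine S n c
  ≡⟨ flipⁿ-run (labelLine S n) 0 c (λ m _ m<c → cong (λ s → step s (labelLine S n m)) (plus m m<c)) ⟩
    flipⁿ c (flipⁿ (firstMinus S n) p)
  ≡⟨ cong (λ k → flipⁿ c (flipⁿ k p)) (firstMinus-≡ S c<n Sc≡⊖ plus) ⟩
    flipⁿ c (flipⁿ c p)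
  ≡⟨ flipⁿ-involutive c p ⟩
    p
  ∎
  where open ≡-Reasoning
... | inj₂ (a , a<c , Sa≡⊖ , plus) = begin
    labelLine S n c
  ≡⟨ steps-across-plus {L = labelLine S n} (λ _ _ → refl) a<c ≤-refl plus ⟩
    flipⁿ (c ∸ a ∸ 1) (step (S a) (labelLine S n a))
  ≡⟨ cong (λ s → flipⁿ (c ∸ a ∸ 1) (step s (labelLine S n a))) Sa≡⊖ ⟩
    flipⁿ (c ∸ a ∸ 1) p
  ≡⟨ gaps a<c c<n Sa≡⊖ Sc≡⊖ plus ⟩
    p
  ∎
  where open ≡-Reasoning

labelLine-compatible : ∀ {S n} → EvenGaps S n → Compatible S (labelLine S n) n
labelLine-compatible {S} gaps m m<n = step⇒crossing (S m) _ (labelLine-⊖ gaps m<n)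

LineCompatible : ∀ {N} → (Fin N → Spin) → (Fin (suc N) → Label) → Set
LineCompatible s ℓ = ∀ c → Crossing (s c) (ℓ (inject₁ c)) (ℓ (fsuc c))

lineCompatible-unique : ∀ {N} {s : Fin N → Spin} {ℓ ℓ′} → LineCompatible s ℓ → LineCompatible s ℓ′ →
                        ℓ fzero ≡ ℓ′ fzero → ∀ k → ℓ k ≡ ℓ′ k
lineCompatible-unique                 _          _           ℓ₀≡ℓ′₀ fzero    = ℓ₀≡ℓ′₀
lineCompatible-unique {suc N} {s} {ℓ} {ℓ′} compatible compatible′ ℓ₀≡ℓ′₀ (fsuc k) =
  lineCompatible-unique (compatible ∘ fsuc) (compatible′ ∘ fsuc) ℓ₁≡ℓ′₁ k
  where
  ℓ₁≡ℓ′₁ : ℓ (fsuc fzero) ≡ ℓ′ (fsuc fzero)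
  ℓ₁≡ℓ′₁ = begin
    ℓ (fsuc fzero)          ≡⟨ crossing⇒step (compatible fzero) ⟩
    step (s fzero) (ℓ fzero)  ≡⟨ cong (step (s fzero)) ℓ₀≡ℓ′₀ ⟩
    step (s fzero) (ℓ′ fzero) ≡⟨ sym (crossing⇒step (compatible′ fzero)) ⟩
    ℓ′ (fsuc fzero)         ∎
    where open ≡-Reasoning

module _ {N} (s : Fin N → Spin) where

  lineCompatible⇒compatible : ∀ {ℓ} → LineCompatible s ℓ → Compatible (pad s ⊕) (pad ℓ p) N
  lineCompatible⇒compatible {ℓ} compatible m m<N =
    subst (λ m → Crossing (pad s ⊕ m) (pad ℓ p m) (pad ℓ p (suc m)))
          (toℕ-fromℕ< m<N) (atToℕ (fromℕ< m<N))
    where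
    atToℕ : ∀ c → Crossing (pad s ⊕ (toℕ c)) (pad ℓ p (toℕ c)) (pad ℓ p (suc (toℕ c)))
    atToℕ c rewrite pad-toℕ s ⊕ c | pad-toℕ ℓ p (fsuc c)
                  | sym (toℕ-inject₁ c) | pad-toℕ ℓ p (inject₁ c) = compatible c

  compatible⇒lineCompatible : ∀ {L} → Compatible (pad s ⊕) L N → LineCompatible s (λ k → L (toℕ k))
  compatible⇒lineCompatible {L} compatible c
    with compatible (toℕ c) (toℕ<n c)
  ... | crossing rewrite pad-toℕ s ⊕ c | toℕ-inject₁ c = crossing

  MinusGap : Fin N → Fin N → Set
  MinusGap l r = toℕ l < toℕ r × s l ≡ ⊖ × s r ≡ ⊖ × (∀ k → toℕ l < toℕ k → toℕ k < toℕ r → s k ≡ ⊕)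

  private
    minusGapᵇ : Fin N → Fin N → Bool
    minusGapᵇ l r = (toℕ l <ᵇ toℕ r) ∧ isMinus (s l) ∧ isMinus (s r)
      ∧ (∀Fin N λ k → ((toℕ l <ᵇ toℕ k) ∧ (toℕ k <ᵇ toℕ r)) ⇒ᵇ isPlus (s k))

    minusGapᵇ⁺ : ∀ {l r} → MinusGap l r → minusGapᵇ l r ≡ true
    minusGapᵇ⁺ {l} {r} (l<r , sl≡⊖ , sr≡⊖ , plus) =
      ∧-true⁺ (<ᵇ-true⁺ l<r) (∧-true⁺ (cong isMinus sl≡⊖) (∧-true⁺ (cong isMinus sr≡⊖)
        (∀Fin-true⁺ λ k → ⇒ᵇ-true⁺ λ between →
          let l<k , k<r = ∧-true⁻ {toℕ l <ᵇ toℕ k} between in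
          cong isPlus (plus k (<ᵇ-true⁻ l<k) (<ᵇ-true⁻ k<r)))))

    minusGapᵇ⁻ : ∀ {l r} → minusGapᵇ l r ≡ true → MinusGap l r
    minusGapᵇ⁻ {l} {r} gap =
      let l<r , rest = ∧-true⁻ {toℕ l <ᵇ toℕ r} gap
          sl , rest  = ∧-true⁻ {isMinus (s l)} rest
          sr , plus  = ∧-true⁻ {isMinus (s r)} rest
      in <ᵇ-true⁻ l<r , isMinus-true⁻ sl , isMinus-true⁻ sr ,
         λ k l<k k<r → isPlus-true⁻ (⇒ᵇ-true⁻ (∀Fin-true⁻ plus k)
                                       (∧-true⁺ (<ᵇ-true⁺ l<k) (<ᵇ-true⁺ k<r)))

  evenLine-true⁻ : evenLine N s ≡ true → ∀ {l r} → MinusGap l r → Evenᵇ (toℕ r ∸ toℕ l ∸ 1)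
  evenLine-true⁻ even {l} {r} gap = ⇒ᵇ-true⁻ (∀Fin-true⁻ (∀Fin-true⁻ even l) r) (minusGapᵇ⁺ gap)

  evenLine-true⁺ : (∀ {l r} → MinusGap l r → Evenᵇ (toℕ r ∸ toℕ l ∸ 1)) → evenLine N s ≡ true
  evenLine-true⁺ even =
    ∀Fin-true⁺ λ l → ∀Fin-true⁺ λ r → ⇒ᵇ-true⁺ λ gap → even {l} {r} (minusGapᵇ⁻ gap)

  private
    toℕ-onto : ∀ {m} → m < N → ∃[ k ] toℕ k ≡ m
    toℕ-onto m<N = fromℕ< m<N , toℕ-fromℕ< m<N

  evenLine⇒evenGaps : evenLine N s ≡ true → EvenGaps (pad s ⊕) N
  evenLine⇒evenGaps even a<b b<N Sa≡⊖ Sb≡⊖ plus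
    with toℕ-onto (<-trans a<b b<N) | toℕ-onto b<N
  ... | l , refl | r , refl = even⇒flipⁿ-p (toℕ r ∸ toℕ l ∸ 1) (evenLine-true⁻ even
          (a<b , trans (sym (pad-toℕ s ⊕ l)) Sa≡⊖ , trans (sym (pad-toℕ s ⊕ r)) Sb≡⊖ ,
           λ k l<k k<r → trans (sym (pad-toℕ s ⊕ k)) (plus (toℕ k) l<k k<r)))

  evenGaps⇒evenLine : EvenGaps (pad s ⊕) N → evenLine N s ≡ true
  evenGaps⇒evenLine gaps = evenLine-true⁺ gapEven
    where
    gapEven : ∀ {l r} → MinusGap l r → Evenᵇ (toℕ r ∸ toℕ l ∸ 1)
    gapEven {l} {r} (l<r , sl≡⊖ , sr≡⊖ , plus) = flipⁿ-p⇒even (toℕ r ∸ toℕ l ∸ 1)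
      (gaps l<r (toℕ<n r) (trans (pad-toℕ s ⊕ l) sl≡⊖) (trans (pad-toℕ s ⊕ r) sr≡⊖) plusBetween)
      where
      plusBetween : PlusBetween (pad s ⊕) (toℕ l) (toℕ r)
      plusBetween m l<m m<r with toℕ-onto (<-trans m<r (toℕ<n r))
      ... | k , refl = trans (pad-toℕ s ⊕ k) (plus k l<m m<r)

  labelsOf : Fin (suc N) → Label
  labelsOf k = labelLine (pad s ⊕) N (toℕ k)

  evenLine⇒lineCompatible : evenLine N s ≡ true → LineCompatible s labelsOf
  evenLine⇒lineCompatible even =
    compatible⇒lineCompatible (labelLine-compatible (evenLine⇒evenGaps even))

  lineCompatible⇒evenLine : ∀ {ℓ} → LineCompatible s ℓ → evenLine N s ≡ true
  lineCompatible⇒evenLine {ℓ} compatible =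
    evenGaps⇒evenLine (compatible⇒evenGaps {L = pad ℓ p} (lineCompatible⇒compatible compatible))

-- Decoding reads the horizontal bonds; by `vertexOK` the vertical ones then agree.
spinOf : Label → Label → Spin
spinOf p p = ⊖
spinOf i i = ⊖
spinOf p i = ⊕
spinOf i p = ⊕

crossing⇒spinOf : ∀ {x w e} → Crossing x w e → spinOf w e ≡ x
crossing⇒spinOf ⊖pp = refl
crossing⇒spinOf ⊕pi = refl
crossing⇒spinOf ⊕ip = refl

crossings⇒vertexOK : ∀ {x n w e s} → Crossing x w e → Crossing x n s → vertexOK n w e s ≡ true
crossings⇒vertexOK ⊖pp ⊖pp = refl
crossings⇒vertexOK ⊕pi ⊕pi = refl
crossings⇒vertexOK ⊕pi ⊕ip = refl
crossings⇒vertexOK ⊕ip ⊕pi = refl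
crossings⇒vertexOK ⊕ip ⊕ip = refl

vertexOK⇒crossings : ∀ n w e s → vertexOK n w e s ≡ true →
                     Crossing (spinOf w e) w e × Crossing (spinOf w e) n s
vertexOK⇒crossings p p p p _ = ⊖pp , ⊖pp
vertexOK⇒crossings p p i i _ = ⊕pi , ⊕pi
vertexOK⇒crossings p i p i _ = ⊕ip , ⊕pi
vertexOK⇒crossings i p i p _ = ⊕pi , ⊕ip
vertexOK⇒crossings i i p p _ = ⊕ip , ⊕ip

entry : ∀ {A : Set} {m n} → Vec (Vec A m) n → Fin n → Fin m → A
entry M r c = lookup (lookup M r) c

entry-tabulate : ∀ {A : Set} {m n} (G : Fin n → Fin m → A) r c →
                 entry (tabulate λ r → tabulate (G r)) r c ≡ G r c
entry-tabulate G r c = trans (cong (λ row → lookup row c) (lookup∘tabulate (tabulate ∘ G) r))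
                             (lookup∘tabulate (G r) c)

lookup-extensionality : ∀ {A : Set} {n} {u v : Vec A n} → (∀ k → lookup u k ≡ lookup v k) → u ≡ v
lookup-extensionality {u = u} {v} same =
  trans (sym (tabulate∘lookup u)) (trans (tabulate-cong same) (tabulate∘lookup v))

entry-extensionality : ∀ {A : Set} {m n} {M M′ : Vec (Vec A m) n} →
                       (∀ r c → entry M r c ≡ entry M′ r c) → M ≡ M′
entry-extensionality same = lookup-extensionality λ r → lookup-extensionality (same r)

module _ {N : ℕ} where

  column : SpinConfig N → Fin N → Fin N → Spin
  column σ c r = entry σ r c

  rowLabels : SpinConfig N → Fin N → Fin (suc N) → Label
  rowLabels σ r = labelsOf (entry σ r)

  columnLabels : SpinConfig N → Fin N → Fin (suc N) → Label
  columnLabels σ c = labelsOf (column σ c)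

  encode : SpinConfig N → PIConfig N
  encode σ = mkPI (tabulate λ r → tabulate (rowLabels σ r)) (tabulate λ c → tabulate (columnLabels σ c))

  decode : PIConfig N → SpinConfig N
  decode (mkPI h v) = tabulate λ r → tabulate λ c → spinOf (entry h r (inject₁ c)) (entry h r (fsuc c))

  module _ (σ : SpinConfig N) (even : isEvenConfig N σ ≡ true) where
    private
      rowCompatible : ∀ r → LineCompatible (entry σ r) (rowLabels σ r)
      rowCompatible r = evenLine⇒lineCompatible (entry σ r) (∀Fin-true⁻ (proj₁ (∧-true⁻ even)) r)

      columnCompatible : ∀ c → LineCompatible (column σ c) (columnLabels σ c)
      columnCompatible c = evenLine⇒lineCompatible (column σ c) (∀Fin-true⁻ (proj₂ (∧-true⁻ even)) c)

    encode-valid : isPIConfig N (encode σ) ≡ true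
    encode-valid = ∀Fin-true⁺ λ r → ∀Fin-true⁺ λ c → vertexOK-at r c
      where
      open PIConfig (encode σ)
      vertexOK-at : ∀ r c → vertexOK (entry vert c (inject₁ r)) (entry horiz r (inject₁ c))
                                     (entry horiz r (fsuc c)) (entry vert c (fsuc r)) ≡ true
      vertexOK-at r c
        rewrite entry-tabulate (rowLabels σ) r (inject₁ c)    | entry-tabulate (rowLabels σ) r (fsuc c)
              | entry-tabulate (columnLabels σ) c (inject₁ r) | entry-tabulate (columnLabels σ) c (fsuc r) =
        crossings⇒vertexOK (rowCompatible r c) (columnCompatible c r)

    decode-encode : decode (encode σ) ≡ σ
    decode-encode = entry-extensionality λ r c → begin
        entry (decode (encode σ)) r c
      ≡⟨ entry-tabulate _ r c ⟩
        spinOf (entry hs r (inject₁ c)) (entry hs r (fsuc c))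
      ≡⟨ cong₂ spinOf (entry-tabulate (rowLabels σ) r (inject₁ c))
                      (entry-tabulate (rowLabels σ) r (fsuc c)) ⟩
        spinOf (rowLabels σ r (inject₁ c)) (rowLabels σ r (fsuc c))
      ≡⟨ crossing⇒spinOf (rowCompatible r c) ⟩
        entry σ r c
      ∎
      where
      open ≡-Reasoning
      hs : Vec (Vec Label (suc N)) N
      hs = PIConfig.horiz (encode σ)

  module _ (h v : Vec (Vec Label (suc N)) N) (valid : isPIConfig N (mkPI h v) ≡ true) where
    private
      crossingsAt : ∀ r c →
        Crossing (entry (decode (mkPI h v)) r c) (entry h r (inject₁ c)) (entry h r (fsuc c)) ×
        Crossing (entry (decode (mkPI h v)) r c) (entry v c (inject₁ r)) (entry v c (fsuc r))
      crossingsAt r c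
        rewrite entry-tabulate (λ r c → spinOf (entry h r (inject₁ c)) (entry h r (fsuc c))) r c =
        vertexOK⇒crossings _ _ _ _ (∀Fin-true⁻ (∀Fin-true⁻ valid r) c)

    rows-compatible : ∀ r → LineCompatible (entry (decode (mkPI h v)) r) (entry h r)
    rows-compatible r c = proj₁ (crossingsAt r c)

    columns-compatible : ∀ c → LineCompatible (column (decode (mkPI h v)) c) (entry v c)
    columns-compatible c r = proj₂ (crossingsAt r c)

    decode-valid : isEvenConfig N (decode (mkPI h v)) ≡ true
    decode-valid = ∧-true⁺
      (∀Fin-true⁺ λ r → lineCompatible⇒evenLine (entry σ r) {entry h r} (rows-compatible r))
      (∀Fin-true⁺ λ c → lineCompatible⇒evenLine (column σ c) {entry v c} (columns-compatible c))
      where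
      σ : SpinConfig N
      σ = decode (mkPI h v)

  boundary : PIConfig N → Vec (Label × Label) N
  boundary (mkPI h v) = tabulate λ k → entry h k fzero , entry v k fzero

  decode-boundary-injective : ∀ {x y} → isPIConfig N x ≡ true → isPIConfig N y ≡ true →
                              decode x ≡ decode y → boundary x ≡ boundary y → x ≡ y
  decode-boundary-injective {mkPI h v} {mkPI h′ v′} valid valid′ sameSpins sameBoundary = cong₂ mkPI
    (entry-extensionality λ r → lineCompatible-unique (rows-compatible h v valid r)
      (subst (λ σ → LineCompatible (entry σ r) (entry h′ r)) (sym sameSpins)
             (rows-compatible h′ v′ valid′ r))
      (cong proj₁ (sameFirst r)))
    (entry-extensionality λ c → lineCompatible-unique (columns-compatible h v valid c)
      (subst (λ σ → LineCompatible (column σ c) (entry v′ c)) (sym sameSpins)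
             (columns-compatible h′ v′ valid′ c))
      (cong proj₂ (sameFirst c)))
    where
    sameFirst : ∀ k → (entry h k fzero , entry v k fzero) ≡ (entry h′ k fzero , entry v′ k fzero)
    sameFirst k = trans (sym (lookup∘tabulate _ k))
                        (trans (cong (λ b → lookup b k) sameBoundary) (lookup∘tabulate _ k))

spins : List Spin
spins = ⊕ ∷ ⊖ ∷ []

labels : List Label
labels = p ∷ i ∷ []

labelPairs : List (Label × Label)
labelPairs = cartesianProduct labels labels

∈-spins : ∀ s → s ∈ spins
∈-spins ⊕ = here refl
∈-spins ⊖ = there (here refl)

∈-labels : ∀ x → x ∈ labels
∈-labels p = here refl
∈-labels i = there (here refl)

spins-unique : Unique spins
spins-unique = ((λ ()) All.∷ All.[]) ∷ All.[] ∷ []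

labels-unique : Unique labels
labels-unique = ((λ ()) All.∷ All.[]) ∷ All.[] ∷ []

allSpinConfigs-unique : ∀ N → Unique (allSpinConfigs N)
allSpinConfigs-unique N = allVecs-unique (allVecs-unique spins-unique N) N

∈-allSpinConfigs : ∀ {N} (σ : SpinConfig N) → σ ∈ allSpinConfigs N
∈-allSpinConfigs = ∈-allVecs (∈-allVecs ∈-spins)

mkPI-injective : ∀ {N} {h h′ v v′ : Vec (Vec Label (suc N)) N} → mkPI h v ≡ mkPI h′ v′ → h ≡ h′ × v ≡ v′
mkPI-injective refl = refl , refl

allBondLines : ∀ N → List (Vec (Vec Label (suc N)) N)
allBondLines N = allVecs N (allVecs (suc N) labels)

∈-allPIConfigs : ∀ {N} (x : PIConfig N) → x ∈ allPIConfigs N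
∈-allPIConfigs (mkPI h v) =
  subst (mkPI h v ∈_) (sym (concatMap-map≡cartesianProductWith mkPI (allBondLines _) (allBondLines _)))
    (∈-cartesianProductWith⁺ mkPI (∈-allVecs (∈-allVecs ∈-labels) h) (∈-allVecs (∈-allVecs ∈-labels) v))

allPIConfigs-unique : ∀ N → Unique (allPIConfigs N)
allPIConfigs-unique N =
  subst Unique (sym (concatMap-map≡cartesianProductWith mkPI (allBondLines N) (allBondLines N)))
    (cartesianProductWith⁺ mkPI mkPI-injective lines-unique lines-unique)
  where
  lines-unique : Unique (allBondLines N)
  lines-unique = allVecs-unique (allVecs-unique labels-unique (suc N)) N

Zeven≤Zpi : ∀ N → Zeven N ≤ Zpi N
Zeven≤Zpi N = count-≤-injection encode
  (λ {σ} {τ} even even′ sameCode →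
     trans (sym (decode-encode σ even)) (trans (cong decode sameCode) (decode-encode τ even′)))
  (allSpinConfigs-unique N)
  (λ {σ} _ even → ∈-allPIConfigs (encode σ) , encode-valid σ even)

Zpi≤Zeven*4^N : ∀ N → Zpi N ≤ Zeven N * 4 ^ N
Zpi≤Zeven*4^N N = subst (Zpi N ≤_) countTarget
  (count-≤-injection (λ x → decode x , boundary x)
    (λ valid valid′ same → decode-boundary-injective valid valid′ (cong proj₁ same) (cong proj₂ same))
    (allPIConfigs-unique N)
    λ { {mkPI h v} _ valid → ∈-cartesianProduct⁺ (∈-allSpinConfigs _) (∈-allVecs ∈-labelPairs _)
                           , decode-valid h v valid })
  where
  ∈-labelPairs : ∀ xy → xy ∈ labelPairs
  ∈-labelPairs (x , y) = ∈-cartesianProduct⁺ (∈-labels x) (∈-labels y)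
  countTarget : count (λ σb → isEvenConfig N (proj₁ σb)) (cartesianProduct (allSpinConfigs N) (allVecs N labelPairs))
              ≡ Zeven N * 4 ^ N
  countTarget =
    trans (count-cartesianProduct-proj₁ (isEvenConfig N) (allSpinConfigs N) (allVecs N labelPairs))
          (cong (Zeven N *_) (length-allVecs N labelPairs))

^-distribʳ-* : ∀ m n o → (m * n) ^ o ≡ m ^ o * n ^ o
^-distribʳ-* m n zero    = refl
^-distribʳ-* m n (suc o) rewrite ^-distribʳ-* m n o =
  solve 4 (λ m n M N → (m :* n) :* (M :* N) := (m :* M) :* (n :* N)) refl m n (m ^ o) (n ^ o)

-- Bernoulli's inequality (1 + 1/a)ⁿ ≥ 1 + n/a, cleared of denominators.
bernoulli : ∀ a n → a ^ n * (a + n) ≤ a * suc a ^ n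
bernoulli a zero = ≤-reflexive (solve 1 (λ a → con 1 :* (a :+ con 0) := a :* con 1) refl a)
bernoulli a (suc n) = begin
    a * aⁿ * (a + suc n)
  ≡⟨ solve 3 (λ a X n → a :* X :* (a :+ (con 1 :+ n)) := a :* (X :* (a :+ n)) :+ X :* a) refl a aⁿ n ⟩
    a * (aⁿ * (a + n)) + aⁿ * a
  ≤⟨ +-monoʳ-≤ (a * (aⁿ * (a + n))) (*-monoʳ-≤ aⁿ (m≤m+n a n)) ⟩
    a * (aⁿ * (a + n)) + aⁿ * (a + n)
  ≡⟨ solve 2 (λ a Z → a :* Z :+ Z := (con 1 :+ a) :* Z) refl a (aⁿ * (a + n)) ⟩
    suc a * (aⁿ * (a + n))
  ≤⟨ *-monoʳ-≤ (suc a) (bernoulli a n) ⟩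
    suc a * (a * suc a ^ n)
  ≡⟨ solve 3 (λ a b Y → b :* (a :* Y) := a :* (b :* Y)) refl a (suc a) (suc a ^ n) ⟩
    a * (suc a * suc a ^ n)
  ∎
  where
  open ≤-Reasoning
  aⁿ : ℕ
  aⁿ = a ^ n

4*[1+k]^N≤[2+k]^N : ∀ k N → 3 * suc k ≤ N → suc k ^ N * 4 ≤ suc (suc k) ^ N
4*[1+k]^N≤[2+k]^N k N 3[1+k]≤N = *-cancelˡ-≤ a (begin
    a * (a ^ N * 4)   ≡⟨ solve 2 (λ a X → a :* (X :* con 4) := X :* (a :+ con 3 :* a)) refl a (a ^ N) ⟩
    a ^ N * (a + 3 * a) ≤⟨ *-monoʳ-≤ (a ^ N) (+-monoʳ-≤ a 3[1+k]≤N) ⟩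
    a ^ N * (a + N)   ≤⟨ bernoulli a N ⟩
    a * suc a ^ N     ∎)
  where
  open ≤-Reasoning
  a : ℕ
  a = suc k

4^N*[1+k]^N²≤[2+k]^N² : ∀ k N → 3 * suc k ≤ N → suc k ^ (N * N) * 4 ^ N ≤ suc (suc k) ^ (N * N)
4^N*[1+k]^N²≤[2+k]^N² k N 3[1+k]≤N = begin
    suc k ^ (N * N) * 4 ^ N      ≡⟨ cong (_* 4 ^ N) (sym (^-*-assoc (suc k) N N)) ⟩
    (suc k ^ N) ^ N * 4 ^ N      ≡⟨ sym (^-distribʳ-* (suc k ^ N) 4 N) ⟩
    (suc k ^ N * 4) ^ N          ≤⟨ ^-monoˡ-≤ N (4*[1+k]^N≤[2+k]^N k N 3[1+k]≤N) ⟩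
    (suc (suc k) ^ N) ^ N        ≡⟨ ^-*-assoc (suc (suc k)) N N ⟩
    suc (suc k) ^ (N * N)        ∎
  where open ≤-Reasoning

mainTheorem2 : ∀ (k : ℕ) → ∃[ N₀ ] ∀ (N : ℕ) → N₀ ≤ N →
    ((suc k) ^ (N * N) * Zeven N ≤ (suc (suc k)) ^ (N * N) * Zpi N)
    × ((suc k) ^ (N * N) * Zpi N ≤ (suc (suc k)) ^ (N * N) * Zeven N)
mainTheorem2 k = 3 * suc k , λ N 3[1+k]≤N →
    *-mono-≤ (^-monoˡ-≤ (N * N) (n≤1+n (suc k))) (Zeven≤Zpi N)
  , (begin
      suc k ^ (N * N) * Zpi N               ≤⟨ *-monoʳ-≤ (suc k ^ (N * N)) (Zpi≤Zeven*4^N N) ⟩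
      suc k ^ (N * N) * (Zeven N * 4 ^ N)   ≡⟨ cong (suc k ^ (N * N) *_) (*-comm (Zeven N) (4 ^ N)) ⟩
      suc k ^ (N * N) * (4 ^ N * Zeven N)   ≡⟨ sym (*-assoc (suc k ^ (N * N)) (4 ^ N) (Zeven N)) ⟩
      suc k ^ (N * N) * 4 ^ N * Zeven N     ≤⟨ *-monoˡ-≤ (Zeven N) (4^N*[1+k]^N²≤[2+k]^N² k N 3[1+k]≤N) ⟩
      suc (suc k) ^ (N * N) * Zeven N       ∎)
  where open ≤-Reasoning
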